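{- Let $G(U,V,E)$ be a bipartite graph with $|U|=|V|=n$ having a perfect matching, with positive weights $b_u$ for $u\in U$, and let $M^*$ be a fixed perfect matching of $G$; for $u\in U$ let $u^*\in V$ denote the partner of $u$ in $M^*$. Fix an arrival order of $V$ and a positive integer $k$, and let $\psi(i)=1-\left(1-\frac{1}{k}\right)^{k-i+1}$ for $i\in\{1,\dots,k\}$. For $\sigma\in\{1,\dots,k\}^U$, run the discrete algorithm with positions $\sigma$. Suppose the vertex $u\in U$ with $\sigma(u)=t$ is unmatched by the algorithm on $\sigma$. Then for every $1\le i\le k$, the algorithm run on $\sigma_u^i$ matches $u^*$ to a vertex $u'\in U$ satisfying $\psi(t)\,b_u\le \psi\big(\sigma_u^i(u')\big)\,b_{u'}$.
   Context: Discrete algorithm with positions $\sigma\in\{1,\dots,k\}^U$: vertices of $V$ arrive one at a time in the fixed order; each arriving $v$ is matched irrevocably to the unmatched neighbor $u\in U$ with the largest value of $b_u\psi(\sigma(u))$ (if any unmatched neighbor exists), ties broken consistently by vertex id. For $\sigma$, $u\in U$ and $1\le i\le k$, $\sigma_u^i$ denotes the assignment with $\sigma_u^i(u)=i$ and $\sigma_u^i(w)=\sigma(w)$ for all $w\ne u$.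
   Formalization: The weights $b_u$ take values in the positive rationals, and ties among neighbours of equal priority go to the smallest vertex id. -}

module Defs where

open import Data.Bool using (Bool; true; false; _∧_; not; if_then_else_)
open import Data.Nat as ℕ using (ℕ; zero; suc; NonZero)
open import Data.Fin using (Fin; toℕ; _≟_)
open import Data.Maybe using (Maybe; just; nothing)
open import Data.List using (List; []; _∷_; filter; allFin; foldl)
open import Data.Integer using (+_)
open import Data.Rational using (ℚ; 1ℚ; _-_; _*_; _/_; _≤ᵇ_)
open import Relation.Nullary using (does)
open import Relation.Nullary.Decidable using (⌊_⌋; T?)

_^ℚ_ : ℚ → ℕ → ℚ
q ^ℚ zero = 1ℚ
q ^ℚ suc m = q * (q ^ℚ m)

-- Positions {1,…,k} are represented by Fin k: j : Fin k stands for position i = toℕ j + 1.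
-- ψ(i) = 1 - (1 - 1/k)^(k - i + 1), so with i = toℕ j + 1 the exponent is k - toℕ j.
ψ : (k : ℕ) .{{_ : NonZero k}} → Fin k → ℚ
ψ k j = 1ℚ - ((1ℚ - (+ 1 / k)) ^ℚ (k ℕ.∸ toℕ j))

_[_≔_] : ∀ {n k} → (Fin n → Fin k) → Fin n → Fin k → (Fin n → Fin k)
(σ [ u ≔ i ]) w = if ⌊ w ≟ u ⌋ then i else σ w

-- Bipartite graph on U = Fin n, V = Fin n given by adjacency E u v (edge between u ∈ U and v ∈ V).
-- State of the algorithm: which vertices of U are matched, and the partner (in U) of each v ∈ V.
record State (n : ℕ) : Set where
  constructor st
  field
    matchedU : Fin n → Bool
    partnerV : Fin n → Maybe (Fin n)
open State public

initial : ∀ {n} → State n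
initial = st (λ _ → false) (λ _ → nothing)

module _ {n k : ℕ} .{{_ : NonZero k}}
         (E : Fin n → Fin n → Bool) (b : Fin n → ℚ) (σ : Fin n → Fin k) where

  key : Fin n → ℚ
  key u = b u * ψ k (σ u)

  -- pick the candidate with largest key; candidates are scanned in increasing
  -- id order and a later one replaces the current only if strictly larger,
  -- so ties are broken in favour of the smallest vertex id.
  pick : Maybe (Fin n) → Fin n → Maybe (Fin n)
  pick nothing u  = just u
  pick (just c) u = if key u ≤ᵇ key c then just c else just u

  choose : State n → Fin n → Maybe (Fin n)
  choose s v = foldl pick nothing
    (filter (λ u → T? (E u v ∧ not (matchedU s u))) (allFin n))

  step : State n → Fin n → State n
  step s v with choose s v
  ... | nothing = s
  ... | just u  = st (λ w → if ⌊ w ≟ u ⌋ then true else matchedU s w)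
                     (λ x → if ⌊ x ≟ v ⌋ then just u else partnerV s x)

  run : List (Fin n) → State n
  run order = foldl step initial order

module Submission where

-- Run the algorithm on σ (run A) and on σ′ = σ_u^i (run B), where u stays
-- unmatched in run A.  Run A never matches u, so at every step the set of
-- matched vertices of A together with u equals the set of matched vertices
-- of B together with one extra vertex x (the invariant `Inv`).  Hence the
-- candidates available to B are those available to A (which never picks u),
-- except that x may be present in B: B's choice is A's choice, or x whose
-- key beats A's choice.  When u* = M*(u) arrives, u is an available
-- candidate of A, so A's choice has key at least b_u ψ(σ(u)), and so has B's.

open import Defs
open import Data.Bool using (Bool; true; false; _∧_; not; if_then_else_; T)
open import Data.Bool.Properties using (∧-zeroʳ)
open import Data.Unit using (tt)
open import Data.Nat using (ℕ; NonZero)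
open import Data.Fin using (Fin; _≟_)
open import Data.Maybe using (Maybe; just; nothing)
open import Data.List using (List; []; _∷_; allFin; filter; foldl)
open import Data.List.Membership.Propositional using (_∈_)
open import Data.List.Membership.Propositional.Properties using (∈-allFin)
open import Data.List.Relation.Unary.Any using (here; there)
open import Data.List.Relation.Binary.Permutation.Propositional using (_↭_; ↭-sym)
open import Data.List.Relation.Binary.Permutation.Propositional.Properties using (∈-resp-↭)
open import Data.Fin.Permutation using (Permutation′; _⟨$⟩ʳ_)
open import Data.Rational using (ℚ; Positive; _≤_; _<_; _*_; _≤ᵇ_)
open import Data.Rational.Properties using (≤ᵇ⇒≤; ≤⇒≤ᵇ; ≤-refl; ≤-trans; ≰⇒>; <⇒≤; ≤-<-trans; <-irrefl; *-comm)
open import Data.Product using (∃-syntax; _×_; _,_; proj₁; proj₂)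
open import Data.Sum using (_⊎_; inj₁; inj₂)
open import Data.Empty using (⊥-elim)
open import Relation.Nullary using (Dec; yes; no)
open import Relation.Nullary.Decidable using (⌊_⌋; T?)
open import Relation.Binary.Definitions using (DecidableEquality)
open import Relation.Binary.PropositionalEquality
  using (_≡_; _≢_; _≗_; refl; sym; trans; cong; cong₂; subst; subst₂; module ≡-Reasoning)

module MaxScan {A : Set} (_≟ᴬ_ : DecidableEquality A) where

  better : (A → ℚ) → Maybe A → A → Maybe A
  better k nothing  w = just w
  better k (just c) w = if k w ≤ᵇ k c then just c else just w

  scan : (A → ℚ) → (A → Bool) → Maybe A → List A → Maybe A
  scan k p acc []      = acc
  scan k p acc (w ∷ l) = scan k p (if p w then better k acc w else acc) l

  better-cases : ∀ k c w → (k w ≤ k c × better k (just c) w ≡ just c)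
                         ⊎ (k c < k w × better k (just c) w ≡ just w)
  better-cases k c w with k w ≤ᵇ k c in eq
  ... | true  = inj₁ (≤ᵇ⇒≤ (subst T (sym eq) tt) , refl)
  ... | false = inj₂ (≰⇒> (λ h → subst T eq (≤⇒≤ᵇ h)) , refl)

  better-self : ∀ k c → better k (just c) c ≡ just c
  better-self k c with better-cases k c c
  ... | inj₁ (_ , e)  = e
  ... | inj₂ (lt , _) = ⊥-elim (<-irrefl refl lt)

  better-agree : ∀ {k₁ k₂ a w} → k₁ a ≡ k₂ a → k₁ w ≡ k₂ w →
                 better k₁ (just a) w ≡ better k₂ (just a) w
  better-agree ka kw rewrite ka | kw = refl

  AtLeast : (A → ℚ) → ℚ → Maybe A → Set
  AtLeast k q r = ∃[ c ] (r ≡ just c × q ≤ k c)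

  better-keeps : ∀ {k q acc} w → AtLeast k q acc → AtLeast k q (better k acc w)
  better-keeps {k} w (c , refl , q≤c) with better-cases k c w
  ... | inj₁ (_ , e)  = c , e , q≤c
  ... | inj₂ (lt , e) = w , e , ≤-trans q≤c (<⇒≤ lt)

  better-offers : ∀ k acc w → AtLeast k (k w) (better k acc w)
  better-offers k nothing  w = w , refl , ≤-refl
  better-offers k (just c) w with better-cases k c w
  ... | inj₁ (w≤c , e) = c , e , w≤c
  ... | inj₂ (_ , e)   = w , e , ≤-refl

  scan-keeps : ∀ {k q} p {acc} l → AtLeast k q acc → AtLeast k q (scan k p acc l)
  scan-keeps p []      h = h
  scan-keeps p (w ∷ l) h with p w
  ... | true  = scan-keeps p l (better-keeps w h)
  ... | false = scan-keeps p l h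

  scan-finds : ∀ k p acc {l w} → w ∈ l → p w ≡ true → AtLeast k (k w) (scan k p acc l)
  scan-finds k p acc {w ∷ l} (here refl) pw rewrite pw = scan-keeps p l (better-offers k acc w)
  scan-finds k p acc {x ∷ l} (there w∈l) pw = scan-finds k p _ w∈l pw

  -- Deleted k₁ k₂ z r₁ r₂: r₁ is the best candidate when z is eligible (keys k₁),
  -- r₂ the best one without z (keys k₂, equal to k₁ away from z): either they
  -- coincide and differ from z, or r₁ is z and z beats r₂.
  data Deleted (k₁ k₂ : A → ℚ) (z : A) : Maybe A → Maybe A → Set where
    none    : Deleted k₁ k₂ z nothing nothing
    same    : ∀ a → a ≢ z → Deleted k₁ k₂ z (just a) (just a)
    only-z  : Deleted k₁ k₂ z (just z) nothing
    z-beats : ∀ a → k₂ a ≤ k₁ z → Deleted k₁ k₂ z (just z) (just a)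

  deleted-absent : ∀ {k₁ k₂ z r₁ r₂} → Deleted k₁ k₂ z r₁ r₂ → r₁ ≢ just z → r₁ ≡ r₂
  deleted-absent none          _  = refl
  deleted-absent (same a _)    _  = refl
  deleted-absent only-z        ne = ⊥-elim (ne refl)
  deleted-absent (z-beats _ _) ne = ⊥-elim (ne refl)

  deleted-raises : ∀ {k z q r₁ r₂} → Deleted k k z r₁ r₂ → AtLeast k q r₂ → AtLeast k q r₁
  deleted-raises (same a _)    h                = h
  deleted-raises (z-beats a h) (.a , refl , le) = _ , refl , ≤-trans le h
  deleted-raises none          (_ , () , _)
  deleted-raises only-z        (_ , () , _)

  module Deletion (k₁ k₂ : A → ℚ) (p q : A → Bool) (z : A)
                  (keys : ∀ w → w ≢ z → k₁ w ≡ k₂ w)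
                  (preds : ∀ w → w ≢ z → p w ≡ q w)
                  (q-z : q z ≡ false) where

    ≤-via-keys : ∀ {w c} → w ≢ z → k₁ w ≤ c → k₂ w ≤ c
    ≤-via-keys {w} w≢z = subst (_≤ _) (keys w w≢z)

    offer-z : ∀ {r₁ r₂} → Deleted k₁ k₂ z r₁ r₂ → Deleted k₁ k₂ z (better k₁ r₁ z) r₂
    offer-z none = only-z
    offer-z (same a a≢z) with better-cases k₁ a z
    ... | inj₁ (_ , e)  rewrite e = same a a≢z
    ... | inj₂ (lt , e) rewrite e = z-beats a (≤-via-keys a≢z (<⇒≤ lt))
    offer-z only-z        rewrite better-self k₁ z = only-z
    offer-z (z-beats a h) rewrite better-self k₁ z = z-beats a h

    offer-other : ∀ {r₁ r₂ w} → w ≢ z → Deleted k₁ k₂ z r₁ r₂ →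
                  Deleted k₁ k₂ z (better k₁ r₁ w) (better k₂ r₂ w)
    offer-other w≢z none = same _ w≢z
    offer-other {w = w} w≢z (same a a≢z)
      rewrite better-agree {k₁} {k₂} {a} {w} (keys a a≢z) (keys w w≢z) with better-cases k₂ a w
    ... | inj₁ (_ , e) rewrite e = same a a≢z
    ... | inj₂ (_ , e) rewrite e = same w w≢z
    offer-other {w = w} w≢z only-z with better-cases k₁ z w
    ... | inj₁ (w≤z , e) rewrite e = z-beats w (≤-via-keys w≢z w≤z)
    ... | inj₂ (_ , e)   rewrite e = same w w≢z
    offer-other {w = w} w≢z (z-beats a a≤z) with better-cases k₁ z w | better-cases k₂ a w
    ... | inj₁ (_ , e)   | inj₁ (_ , e′) rewrite e | e′ = z-beats a a≤z
    ... | inj₁ (w≤z , e) | inj₂ (_ , e′) rewrite e | e′ = z-beats w (≤-via-keys w≢z w≤z)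
    ... | inj₂ (_ , e)   | inj₂ (_ , e′) rewrite e | e′ = same w w≢z
    ... | inj₂ (z<w , _) | inj₁ (w≤a , _) =
      ⊥-elim (<-irrefl (sym (keys w w≢z)) (≤-<-trans (≤-trans w≤a a≤z) z<w))

    scan-delete : ∀ {r₁ r₂} l → Deleted k₁ k₂ z r₁ r₂ →
                  Deleted k₁ k₂ z (scan k₁ p r₁ l) (scan k₂ q r₂ l)
    scan-delete []      R = R
    scan-delete (w ∷ l) R with w ≟ᴬ z
    scan-delete (w ∷ l) R | yes refl rewrite q-z with p w
    ... | true  = scan-delete l (offer-z R)
    ... | false = scan-delete l R
    scan-delete (w ∷ l) R | no w≢z rewrite preds w w≢z with q w
    ... | true  = scan-delete l (offer-other w≢z R)
    ... | false = scan-delete l R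

module Insertion {A : Set} (_≟ᴬ_ : DecidableEquality A) where

  insert : A → (A → Bool) → (A → Bool)
  insert z m w = if ⌊ w ≟ᴬ z ⌋ then true else m w

  insert-self : ∀ z m → insert z m z ≡ true
  insert-self z m with z ≟ᴬ z
  ... | yes _ = refl
  ... | no ne = ⊥-elim (ne refl)

  insert-other : ∀ m {z w} → w ≢ z → insert z m w ≡ m w
  insert-other m {z} {w} w≢z with w ≟ᴬ z
  ... | yes e = ⊥-elim (w≢z e)
  ... | no _  = refl

  insert-false : ∀ z m {w} → insert z m w ≡ false → m w ≡ false
  insert-false z m {w} h with w ≟ᴬ z
  ... | no _ = h

  insert-idem : ∀ z m → insert z (insert z m) ≗ insert z m
  insert-idem z m w with w ≟ᴬ z
  ... | yes _ = refl
  ... | no _  = refl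

  insert-comm : ∀ y z m → insert y (insert z m) ≗ insert z (insert y m)
  insert-comm y z m w with w ≟ᴬ y | w ≟ᴬ z
  ... | yes _ | yes _ = refl
  ... | yes _ | no _  = refl
  ... | no _  | yes _ = refl
  ... | no _  | no _  = refl

  insert-cong : ∀ z {m m′} → m ≗ m′ → insert z m ≗ insert z m′
  insert-cong z m≗m′ w = cong (if ⌊ w ≟ᴬ z ⌋ then true else_) (m≗m′ w)

module Algorithm {n k : ℕ} .{{_ : NonZero k}} (E : Fin n → Fin n → Bool) (b : Fin n → ℚ) where

  open MaxScan (_≟_ {n})
  open Insertion (_≟_ {n})

  avail : Fin n → (Fin n → Bool) → Fin n → Bool
  avail v m w = E w v ∧ not (m w)

  avail-insert-self : ∀ v m z → avail v (insert z m) z ≡ false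
  avail-insert-self v m z rewrite insert-self z m = ∧-zeroʳ (E z v)

  avail-insert-other : ∀ v m {z w} → w ≢ z → avail v m w ≡ avail v (insert z m) w
  avail-insert-other v m {w = w} w≢z = cong (λ x → E w v ∧ not x) (sym (insert-other m w≢z))

  filter-scan : ∀ (τ : Fin n → Fin k) (p : Fin n → Bool) acc l →
    foldl (pick E b τ) acc (filter (λ w → T? (p w)) l) ≡ scan (key E b τ) p acc l
  filter-scan τ p acc [] = refl
  filter-scan τ p acc (w ∷ l) with p w
  ... | false = filter-scan τ p acc l
  ... | true  = trans (cong (λ a → foldl (pick E b τ) a (filter (λ w → T? (p w)) l)) (pick-better acc))
                      (filter-scan τ p (better (key E b τ) acc w) l)
    where
    pick-better : ∀ acc → pick E b τ acc w ≡ better (key E b τ) acc w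
    pick-better nothing  = refl
    pick-better (just _) = refl

  choose-scan : ∀ τ s v → choose E b τ s v ≡ scan (key E b τ) (avail v (matchedU s)) nothing (allFin n)
  choose-scan τ s v = filter-scan τ (avail v (matchedU s)) nothing (allFin n)

  commit : State n → Fin n → Maybe (Fin n) → State n
  commit s v nothing  = s
  commit s v (just c) = st (insert c (matchedU s)) (λ y → if ⌊ y ≟ v ⌋ then just c else partnerV s y)

  step-commit : ∀ τ s v → step E b τ s v ≡ commit s v (choose E b τ s v)
  step-commit τ s v with choose E b τ s v
  ... | nothing = refl
  ... | just _  = refl

  unmatched-commit : ∀ {s v w} r → matchedU (commit s v r) w ≡ false →
                     matchedU s w ≡ false × r ≢ just w
  unmatched-commit nothing  h = h , λ ()
  unmatched-commit {s} (just c) h = insert-false c (matchedU s) h , chosen-is-matched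
    where
    chosen-is-matched : just c ≢ just _
    chosen-is-matched refl with trans (sym (insert-self c (matchedU s))) h
    ... | ()

  unmatched-step : ∀ τ {s v w} → matchedU (step E b τ s v) w ≡ false →
                   matchedU s w ≡ false × choose E b τ s v ≢ just w
  unmatched-step τ {s} {v} {w} h =
    unmatched-commit (choose E b τ s v) (subst (λ s′ → matchedU s′ w ≡ false) (step-commit τ s v) h)

  unmatched-run : ∀ τ {s w} l → matchedU (foldl (step E b τ) s l) w ≡ false → matchedU s w ≡ false
  unmatched-run τ []      h = h
  unmatched-run τ (v ∷ l) h = proj₁ (unmatched-step τ (unmatched-run τ l h))

  commit-records : ∀ {κ q s v} r → AtLeast κ q r → AtLeast κ q (partnerV (commit s v r) v)
  commit-records {v = v} .(just c) (c , refl , le) with v ≟ v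
  ... | yes _ = c , refl , le
  ... | no ne = ⊥-elim (ne refl)

  step-elsewhere : ∀ τ s {v y} → y ≢ v → partnerV (step E b τ s v) y ≡ partnerV s y
  step-elsewhere τ s {v} {y} y≢v rewrite step-commit τ s v with choose E b τ s v
  ... | nothing = refl
  ... | just _ with y ≟ v
  ...   | yes e = ⊥-elim (y≢v e)
  ...   | no _  = refl

module Coupling {n k : ℕ} .{{_ : NonZero k}} (E : Fin n → Fin n → Bool) (b : Fin n → ℚ)
                (σ : Fin n → Fin k) (u : Fin n) (i : Fin k)
                (us : Fin n) (u-us : E u us ≡ true) where

  open MaxScan (_≟_ {n})
  open Insertion (_≟_ {n})
  open Algorithm E b

  σ′ : Fin n → Fin k
  σ′ = σ [ u ≔ i ]

  kA kB : Fin n → ℚ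
  kA = key E b σ
  kB = key E b σ′

  keys-agree : ∀ w → w ≢ u → kA w ≡ kB w
  keys-agree w w≢u with w ≟ u
  ... | yes e = ⊥-elim (w≢u e)
  ... | no _  = refl

  record Inv (sA sB : State n) (x : Fin n) : Set where
    constructor balanced
    field same-sets : insert u (matchedU sA) ≗ insert x (matchedU sB)
  open Inv

  choices-coupled : ∀ {sA sB x} v → Inv sA sB x → choose E b σ sA v ≢ just u →
                    Deleted kB kB x (choose E b σ′ sB v) (choose E b σ sA v)
  choices-coupled {sA} {sB} {x} v inv noU
    rewrite choose-scan σ′ sB v | choose-scan σ sA v =
    subst (Deleted kB kB x _) (sym (deleted-absent viaA noU)) viaB
    where
    R : Fin n → Bool
    R = avail v (insert u (matchedU sA))
    R-as-B : ∀ w → avail v (insert x (matchedU sB)) w ≡ R w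
    R-as-B w = cong (λ m → E w v ∧ not m) (sym (same-sets inv w))
    viaA : Deleted kA kB u (scan kA (avail v (matchedU sA)) nothing (allFin n)) (scan kB R nothing (allFin n))
    viaA = Deletion.scan-delete kA kB _ R u keys-agree (λ _ → avail-insert-other v (matchedU sA))
             (avail-insert-self v (matchedU sA) u) (allFin n) none
    viaB : Deleted kB kB x (scan kB (avail v (matchedU sB)) nothing (allFin n)) (scan kB R nothing (allFin n))
    viaB = Deletion.scan-delete kB kB _ R x (λ _ _ → refl)
             (λ w w≢x → trans (avail-insert-other v (matchedU sB) w≢x) (R-as-B w))
             (trans (sym (R-as-B x)) (avail-insert-self v (matchedU sB) x)) (allFin n) none

  inv-commit : ∀ {κ sA sB x v rA rB} → Inv sA sB x → Deleted κ κ x rB rA →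
               ∃[ x′ ] Inv (commit sA v rA) (commit sB v rB) x′
  inv-commit {x = x} inv none = x , inv
  inv-commit {sA = sA} {sB} {x} inv (same a _) = x , balanced λ w → begin
    insert u (insert a (matchedU sA)) w ≡⟨ insert-comm u a (matchedU sA) w ⟩
    insert a (insert u (matchedU sA)) w ≡⟨ insert-cong a (same-sets inv) w ⟩
    insert a (insert x (matchedU sB)) w ≡⟨ insert-comm a x (matchedU sB) w ⟩
    insert x (insert a (matchedU sB)) w ∎
    where open ≡-Reasoning
  inv-commit {sB = sB} {x} inv only-z =
    x , balanced λ w → trans (same-sets inv w) (sym (insert-idem x (matchedU sB) w))
  inv-commit {sA = sA} inv (z-beats a _) =
    a , balanced λ w → trans (insert-comm u a (matchedU sA) w) (insert-cong a (same-sets inv) w)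

  inv-step : ∀ {sA sB x} v → Inv sA sB x → choose E b σ sA v ≢ just u →
             ∃[ x′ ] Inv (step E b σ sA v) (step E b σ′ sB v) x′
  inv-step {sA} {sB} v inv noU rewrite step-commit σ sA v | step-commit σ′ sB v =
    inv-commit {v = v} inv (choices-coupled v inv noU)

  Good : Maybe (Fin n) → Set
  Good = AtLeast kB (kA u)

  -- when u* arrives, u is available to A, so B's choice has key ≥ b_u ψ(σ(u))
  arrival : ∀ {sA sB x} → Inv sA sB x → matchedU sA u ≡ false → choose E b σ sA us ≢ just u →
            Good (partnerV (step E b σ′ sB us) us)
  arrival {sA} {sB} inv mAu noU rewrite step-commit σ′ sB us =
    commit-records (choose E b σ′ sB us) (deleted-raises {q = kA u} (choices-coupled us inv noU) A-choice)
    where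
    u-avail : avail us (matchedU sA) u ≡ true
    u-avail = cong₂ (λ e m → e ∧ not m) u-us mAu
    A-finds-u : AtLeast kA (kA u) (choose E b σ sA us)
    A-finds-u = subst (AtLeast kA (kA u)) (sym (choose-scan σ sA us))
                  (scan-finds kA _ nothing (∈-allFin u) u-avail)
    A-choice : Good (choose E b σ sA us)
    A-choice with A-finds-u
    ... | c , e , le = c , e , subst (kA u ≤_) (keys-agree c λ { refl → noU e }) le

  coupled-run : ∀ l {sA sB x} → Inv sA sB x → matchedU (foldl (step E b σ) sA l) u ≡ false →
                Good (partnerV sB us) ⊎ us ∈ l → Good (partnerV (foldl (step E b σ′) sB l) us)
  coupled-run [] _ _ (inj₁ good) = good
  coupled-run (v ∷ l) {sA} {sB} inv unmatched reached =
    coupled-run l (proj₂ (inv-step v inv noU)) unmatched (next (v ≟ us) reached)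
    where
    A-step : matchedU sA u ≡ false × choose E b σ sA v ≢ just u
    A-step = unmatched-step σ (unmatched-run σ l unmatched)
    noU : choose E b σ sA v ≢ just u
    noU = proj₂ A-step
    next : Dec (v ≡ us) → Good (partnerV sB us) ⊎ us ∈ v ∷ l → Good (partnerV (step E b σ′ sB v) us) ⊎ us ∈ l
    next (yes refl) _                  = inj₁ (arrival inv (proj₁ A-step) noU)
    next (no v≢us) (inj₁ good)         = inj₁ (subst Good (sym (step-elsewhere σ′ sB (λ e → v≢us (sym e)))) good)
    next (no v≢us) (inj₂ (here e))     = ⊥-elim (v≢us (sym e))
    next (no _)    (inj₂ (there us∈l)) = inj₂ us∈l

-- Couple the two runs from the empty matching, with u* reached because the
-- arrival order is a permutation of V.
lemma2 : (n k : ℕ) .{{_ : NonZero k}}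
         (E : Fin n → Fin n → Bool)
         (b : Fin n → ℚ) → (∀ u → Positive (b u)) →
         (Mstar : Permutation′ n) → (∀ u → E u (Mstar ⟨$⟩ʳ u) ≡ true) →
         (order : List (Fin n)) → order ↭ allFin n →
         (σ : Fin n → Fin k) (u : Fin n) (t : Fin k) → σ u ≡ t →
         State.matchedU (run E b σ order) u ≡ false →
         (i : Fin k) →
         ∃[ u′ ] (State.partnerV (run E b (σ [ u ≔ i ]) order) (Mstar ⟨$⟩ʳ u) ≡ just u′
                  × ψ k t * b u ≤ ψ k ((σ [ u ≔ i ]) u′) * b u′)
lemma2 n k E b _ Mstar matching order order↭ σ u .(σ u) refl unmatched i
  with coupled-run order {initial} {initial} {u} (balanced λ _ → refl) unmatched (inj₂ us∈order)
  where
  open Coupling E b σ u i (Mstar ⟨$⟩ʳ u) (matching u)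
  us∈order : Mstar ⟨$⟩ʳ u ∈ order
  us∈order = ∈-resp-↭ (↭-sym order↭) (∈-allFin (Mstar ⟨$⟩ʳ u))
... | u′ , e , le = u′ , e , subst₂ _≤_ (*-comm (b u) _) (*-comm (b u′) _) le
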